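{- For every partition $\lambda$, the misère Grundy value of $\lambda$ in \textsc{RIT} equals the misère Grundy value of $\mathrm{rem}(\lambda)$ in \textsc{Nim}: $\mathcal{G}^-_{\textsc{RIT}}(\lambda)=\mathcal{G}^-_{\textsc{Nim}}(\mathrm{rem}(\lambda))$.
   Context: An \textsc{RIT} (Row Impartial Terminus) position is a partition $\lambda=(\lambda_1,\dots,\lambda_r)$, written as a nonincreasing tuple of nonnegative integers (a move keeps the length $r$ of the tuple, zero entries being allowed; the empty partition is the unique terminal position). For $k\in[1,\lambda_1]$, there is a move from $\lambda$ to $\bar\lambda$ where $\bar\lambda_i=k-1$ for $i$ the largest index with $\lambda_i\ge k$, and $\bar\lambda_j=\lambda_j$ for $j\ne i$. Informally, a move shortens one row of the Young diagram so that the result is still a Young diagram. Define $\mathrm{rem}(\lambda)$ to be the $\lceil r/2\rceil$-tuple $(\lambda_1-\lambda_2,\lambda_3-\lambda_4,\dots,\lambda_{2\lceil r/2\rceil-1}-\lambda_{2\lceil r/2\rceil})$, where $\lambda_j=0$ for $j>r$. \textsc{Nim} is played on tuples of nonnegative integers: a move decreases exactly one coordinate by a positive amount; its terminal positions are the all-zero tuples (including the empty tuple). The misère Grundy value $\mathcal{G}^-$ is defined recursively by $\mathcal{G}^-(x)=1$ if $x$ is terminal and $\mathcal{G}^-(x)=\mathrm{mex}\{\mathcal{G}^-(y): x\to y\}$ otherwise, where $\mathrm{mex}(S)$ is the least nonnegative integer not in $S$. -}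

module Defs where

open import Data.Nat using (ℕ; zero; suc; _∸_; _≤ᵇ_; _≡ᵇ_; _≥_)
open import Data.Bool using (Bool; true; false; if_then_else_; _∨_)
open import Data.List using (List; []; _∷_; map; _++_; upTo; length)
open import Data.Bool.ListAction using (any)
open import Data.Nat.ListAction using (sum)
open import Data.List.Relation.Unary.Linked using (Linked)

-- Partitions: nonincreasing tuples of naturals (fixed length r = length of list).
IsPartition : List ℕ → Set
IsPartition = Linked _≥_

memb : ℕ → List ℕ → Bool
memb n []       = false
memb n (x ∷ xs) = (n ≡ᵇ x) ∨ memb n xs

-- mex: least natural not in the list (it is at most the length of the list)
mexAux : ℕ → ℕ → List ℕ → ℕ
mexAux zero    n xs = n
mexAux (suc f) n xs = if memb n xs then mexAux f (suc n) xs else n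

mex : List ℕ → ℕ
mex xs = mexAux (suc (length xs)) 0 xs

-- With fuel ≥ the sum of the entries (which strictly decreases along
-- every move in both games below) this is the recursive definition
-- G⁻(x) = 1 if x is terminal, mex {G⁻(y) : x → y} otherwise.
grundyMisère : {A : Set} → (A → List A) → ℕ → A → ℕ
grundyMisère moves zero    a = 1
grundyMisère moves (suc f) a with moves a
... | []       = 1
... | (m ∷ ms) = mex (map (grundyMisère moves f) (m ∷ ms))

headOr0 : List ℕ → ℕ
headOr0 []      = 0
headOr0 (x ∷ _) = x

-- ritMove k λ : set λ_i := k - 1 for i the largest index with λ_i ≥ k
ritMove : ℕ → List ℕ → List ℕ
ritMove k []       = []
ritMove k (x ∷ xs) =
  if any (λ y → k ≤ᵇ y) xs then x ∷ ritMove k xs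
  else (if k ≤ᵇ x then (k ∸ 1) ∷ xs else x ∷ xs)

ritMoves : List ℕ → List (List ℕ)
ritMoves λs = map (λ j → ritMove (suc j) λs) (upTo (headOr0 λs))

grundyRIT : List ℕ → ℕ
grundyRIT λs = grundyMisère ritMoves (sum λs) λs

nimMoves : List ℕ → List (List ℕ)
nimMoves []       = []
nimMoves (x ∷ xs) = map (_∷ xs) (upTo x) ++ map (x ∷_) (nimMoves xs)

grundyNim : List ℕ → ℕ
grundyNim xs = grundyMisère nimMoves (sum xs) xs

-- rem(λ) = (λ₁ - λ₂, λ₃ - λ₄, …), length ⌈r/2⌉, λ_j = 0 for j > r

rem : List ℕ → List ℕ
rem []           = []
rem (a ∷ [])     = a ∷ []
rem (a ∷ b ∷ xs) = (a ∸ b) ∷ rem xs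

-- Every RIT move changes rem λ by a single Nim move, taken either forwards or backwards, and
-- every Nim move from rem λ is realised by an RIT move.  Since a misère Grundy value differs
-- from the values of all options, induction shows that the values of the options of λ avoid
-- G⁻(rem λ) and contain every smaller value, except possibly 0 when rem λ is terminal
-- (value 1) while λ is not.  Then shortening a longest row by one box turns rem λ into a
-- single heap of size 1, of misère value 0.
module Submission where

open import Defs
open import Data.Bool using (true; false; T)
open import Data.Bool.ListAction using (any)
open import Data.Bool.Properties using (T-∨)
open import Data.Fin.Properties using (toℕ<n; pigeonhole)
open import Data.List using (List; []; _∷_; map; length; lookup; upTo)
open import Data.List.Membership.Propositional using (_∈_; _∉_)
open import Data.List.Membership.Propositional.Properties
  using (∈-map⁺; ∈-map⁻; ∈-++⁺ˡ; ∈-++⁺ʳ; ∈-++⁻; ∈-upTo⁺; ∈-upTo⁻)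
open import Data.List.Properties using (map-cong-local)
open import Data.List.Relation.Unary.All using (tabulate)
open import Data.List.Relation.Unary.Any using (here; there; index)
open import Data.List.Relation.Unary.Any.Properties using (lookup-index)
open import Data.List.Relation.Unary.Linked using ([]; [-]; _∷_; tail)
open import Data.Nat
  using (ℕ; _+_; _∸_; _≤_; _<_; _≤′_; _≤ᵇ_; zero; suc; z≤n; s≤s; z<s; ≤′-refl; ≤′-step)
open import Data.Nat.Induction using (<-wellFounded)
open import Data.Nat.ListAction using (sum)
open import Data.Nat.Properties
open import Data.Product using (_×_; _,_; ∃-syntax)
open import Data.Sum as Sum using (_⊎_; inj₁; inj₂; [_,_]′)
open import Function using (_∘_; Equivalence)
open import Induction.WellFounded using (Acc; acc)
open import Relation.Binary.Definitions using (tri<; tri≈; tri>)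
open import Relation.Binary.PropositionalEquality
  using (_≡_; _≢_; refl; sym; trans; cong; cong₂; subst; module ≡-Reasoning)
open import Relation.Nullary using (yes; no; contradiction)
open import Relation.Nullary.Reflects using (Reflects; ofʸ; ofⁿ; fromEquivalence; det)

memb⇒∈ : ∀ {n} xs → T (memb n xs) → n ∈ xs
memb⇒∈ {n} (x ∷ xs) t = [ here ∘ ≡ᵇ⇒≡ n x , there ∘ memb⇒∈ xs ]′ (Equivalence.to T-∨ t)

∈⇒memb : ∀ {n xs} → n ∈ xs → T (memb n xs)
∈⇒memb {n} (here refl) = Equivalence.from T-∨ (inj₁ (≡⇒≡ᵇ n n refl))
∈⇒memb (there n∈xs)    = Equivalence.from T-∨ (inj₂ (∈⇒memb n∈xs))

memb-reflects-∈ : ∀ n xs → Reflects (n ∈ xs) (memb n xs)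
memb-reflects-∈ n xs = fromEquivalence (memb⇒∈ xs) ∈⇒memb

infix 4 Below_⊆_

Below_⊆_ : ℕ → List ℕ → Set
Below n ⊆ xs = ∀ {w} → w < n → w ∈ xs

Below-suc : ∀ {n xs} → Below n ⊆ xs → n ∈ xs → Below suc n ⊆ xs
Below-suc below n∈xs w<1+n with m<1+n⇒m<n∨m≡n w<1+n
... | inj₁ w<n  = below w<n
... | inj₂ refl = n∈xs

-- Pigeonhole on w ↦ (position of w in xs), which is injective on w < n.
Below⊆⇒≤length : ∀ {n xs} → Below n ⊆ xs → n ≤ length xs
Below⊆⇒≤length {n} {xs} below with n ≤? length xs
... | yes n≤len = n≤len
... | no  n≰len
  with i , j , i<j , same-index ← pigeonhole (≰⇒> n≰len) (index ∘ below ∘ toℕ<n)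
  = contradiction (trans (lookup-index (below (toℕ<n i)))
                    (trans (cong (lookup xs) same-index) (sym (lookup-index (below (toℕ<n j))))))
                  (<⇒≢ i<j)

mexAux-Below : ∀ f n xs → Below n ⊆ xs → Below mexAux f n xs ⊆ xs
mexAux-Below zero    n xs below = below
mexAux-Below (suc f) n xs below with memb n xs | memb-reflects-∈ n xs
... | true  | ofʸ n∈xs = mexAux-Below f (suc n) xs (Below-suc below n∈xs)
... | false | _        = below

mexAux-∉ : ∀ f n xs → Below n ⊆ xs → length xs < f + n → mexAux f n xs ∉ xs
mexAux-∉ zero    n xs below len< = contradiction (Below⊆⇒≤length below) (<⇒≱ len<)
mexAux-∉ (suc f) n xs below len< with memb n xs | memb-reflects-∈ n xs
... | true  | ofʸ n∈xs =
  mexAux-∉ f (suc n) xs (Below-suc below n∈xs) (subst (length xs <_) (sym (+-suc f n)) len<)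
... | false | ofⁿ n∉xs = n∉xs

mex-Below : ∀ xs → Below mex xs ⊆ xs
mex-Below xs = mexAux-Below (suc (length xs)) 0 xs λ ()

mex-∉ : ∀ xs → mex xs ∉ xs
mex-∉ xs = mexAux-∉ (suc (length xs)) 0 xs (λ ()) (s≤s (m≤m+n (length xs) 0))

mex-unique : ∀ {v} xs → v ∉ xs → Below v ⊆ xs → mex xs ≡ v
mex-unique {v} xs v∉xs below with <-cmp (mex xs) v
... | tri< mex<v _ _ = contradiction (below mex<v) (mex-∉ xs)
... | tri≈ _ mex≡v _ = mex≡v
... | tri> _ _ v<mex = contradiction (mex-Below xs v<mex) v∉xs

mex⁻ : List ℕ → ℕ
mex⁻ []         = 1
mex⁻ xs@(_ ∷ _) = mex xs

mex⁻-∉ : ∀ xs → mex⁻ xs ∉ xs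
mex⁻-∉ []         = λ ()
mex⁻-∉ xs@(_ ∷ _) = mex-∉ xs

mex⁻-unique : ∀ {x v xs} → x ∈ xs → v ∉ xs → Below v ⊆ xs → mex⁻ xs ≡ v
mex⁻-unique {xs = []}    ()
mex⁻-unique {xs = _ ∷ _} _  = mex-unique _

module Grundy {A : Set} (moves : A → List A) (μ : A → ℕ)
              (μ-decreasing : ∀ a {a'} → a' ∈ moves a → μ a' < μ a) where

  grundy : A → ℕ
  grundy a = grundyMisère moves (μ a) a

  μ≡0⇒terminal : ∀ {a} → μ a ≡ 0 → moves a ≡ []
  μ≡0⇒terminal {a} μ≡0 with moves a | μ-decreasing a
  ... | []    | _         = refl
  ... | _ ∷ _ | decreasing = contradiction (subst (μ _ <_) μ≡0 (decreasing (here refl))) n≮0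

  grundyMisère-suc : ∀ f a →
                     grundyMisère moves (suc f) a ≡ mex⁻ (map (grundyMisère moves f) (moves a))
  grundyMisère-suc f a with moves a
  ... | []    = refl
  ... | _ ∷ _ = refl

  grundyMisère-stable : ∀ f a → μ a ≤ f → grundyMisère moves (suc f) a ≡ grundyMisère moves f a
  grundyMisère-stable zero a μ≤0
    rewrite grundyMisère-suc 0 a | μ≡0⇒terminal (n≤0⇒n≡0 μ≤0) = refl
  grundyMisère-stable (suc f) a μ≤1+f
    rewrite grundyMisère-suc (suc f) a | grundyMisère-suc f a
    = cong mex⁻ (map-cong-local (tabulate λ a'∈ →
        grundyMisère-stable f _ (≤-pred (≤-trans (μ-decreasing a a'∈) μ≤1+f))))

  grundyMisère-fuel : ∀ {f a} → μ a ≤′ f → grundyMisère moves f a ≡ grundy a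
  grundyMisère-fuel ≤′-refl                = refl
  grundyMisère-fuel {a = a} (≤′-step μ≤′f) =
    trans (grundyMisère-stable _ a (≤′⇒≤ μ≤′f)) (grundyMisère-fuel μ≤′f)

  grundy-unfold : ∀ a → grundy a ≡ mex⁻ (map grundy (moves a))
  grundy-unfold a = begin
    grundy a                                        ≡⟨ grundyMisère-fuel (≤′-step ≤′-refl) ⟨
    grundyMisère moves (suc (μ a)) a                ≡⟨ grundyMisère-suc (μ a) a ⟩
    mex⁻ (map (grundyMisère moves (μ a)) (moves a)) ≡⟨ cong mex⁻ (map-cong-local (tabulate options)) ⟩
    mex⁻ (map grundy (moves a))                     ∎
    where
    open ≡-Reasoning
    options : ∀ {a'} → a' ∈ moves a → grundyMisère moves (μ a) a' ≡ grundy a'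
    options a'∈ = grundyMisère-fuel (≤⇒≤′ (<⇒≤ (μ-decreasing a a'∈)))

  grundy-terminal : ∀ {a} → moves a ≡ [] → grundy a ≡ 1
  grundy-terminal {a} terminal = trans (grundy-unfold a) (cong (mex⁻ ∘ map grundy) terminal)

  grundy-option-≢ : ∀ {a a'} → a' ∈ moves a → grundy a' ≢ grundy a
  grundy-option-≢ {a} a'∈ g≡ =
    mex⁻-∉ (map grundy (moves a)) (subst (_∈ _) (trans g≡ (grundy-unfold a)) (∈-map⁺ grundy a'∈))

  below-grundy : ∀ {a w} → w < grundy a →
                 (moves a ≡ [] × w ≡ 0) ⊎ ∃[ a' ] a' ∈ moves a × w ≡ grundy a'
  below-grundy {a} {w} w< with moves a | subst (w <_) (grundy-unfold a) w<
  ... | []    | w<1   = inj₁ (refl , n<1⇒n≡0 w<1)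
  ... | _ ∷ _ | w<mex = inj₂ (∈-map⁻ grundy (mex-Below _ w<mex))

  grundy-unique : ∀ {a a₀ v} → a₀ ∈ moves a →
                  (∀ {a'} → a' ∈ moves a → grundy a' ≢ v) →
                  (∀ {w} → w < v → ∃[ a' ] a' ∈ moves a × w ≡ grundy a') →
                  grundy a ≡ v
  grundy-unique {a} a₀∈ avoids covers = trans (grundy-unfold a) (mex⁻-unique (∈-map⁺ grundy a₀∈)
    (λ v∈ → let a' , a'∈ , v≡ = ∈-map⁻ grundy v∈ in avoids a'∈ (sym v≡))
    (λ w< → let a' , a'∈ , w≡ = covers w< in subst (_∈ _) (sym w≡) (∈-map⁺ grundy a'∈)))

module GrundyTransfer {A B : Set}
  (movesA : A → List A) (μA : A → ℕ) (μA-decreasing : ∀ a {a'} → a' ∈ movesA a → μA a' < μA a)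
  (movesB : B → List B) (μB : B → ℕ) (μB-decreasing : ∀ b {b'} → b' ∈ movesB b → μB b' < μB b)
  where

  private
    module GA = Grundy movesA μA μA-decreasing
    module GB = Grundy movesB μB μB-decreasing

  module _
    (f : A → B) (P : A → Set)
    (P-closed : ∀ {a a'} → P a → a' ∈ movesA a → P a')
    (adjacent : ∀ {a a'} → P a → a' ∈ movesA a → f a' ∈ movesB (f a) ⊎ f a ∈ movesB (f a'))
    (lift     : ∀ {a b} → P a → b ∈ movesB (f a) → ∃[ a' ] a' ∈ movesA a × f a' ≡ b)
    -- A non-terminal position may have a terminal image, of value 1; the option of value 0
    -- that its own value then requires cannot come from `lift`.
    (escape   : ∀ {a a'} → P a → movesB (f a) ≡ [] → a' ∈ movesA a →
                ∃[ a'' ] a'' ∈ movesA a × GB.grundy (f a'') ≡ 0)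
    where

    terminal-image : ∀ {a} → P a → movesA a ≡ [] → movesB (f a) ≡ []
    terminal-image {a} pa terminal with movesB (f a) in eq
    ... | []    = refl
    ... | b ∷ _ with _ , a'∈ , _ ← lift pa (subst (b ∈_) (sym eq) (here refl)) =
      contradiction (subst (_ ∈_) terminal a'∈) λ ()

    grundy-transfer-acc : ∀ {a} → Acc _<_ (μA a) → P a → GA.grundy a ≡ GB.grundy (f a)
    grundy-transfer-acc {a} (acc rec) pa with movesA a in eq
    ... | [] = trans (GA.grundy-terminal eq) (sym (GB.grundy-terminal (terminal-image pa eq)))
    ... | a₀ ∷ _ = GA.grundy-unique a₀∈ avoids covers
      where
      a₀∈ : a₀ ∈ movesA a
      a₀∈ = subst (a₀ ∈_) (sym eq) (here refl)

      IH : ∀ {a'} → a' ∈ movesA a → GA.grundy a' ≡ GB.grundy (f a')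
      IH a'∈ = grundy-transfer-acc (rec (μA-decreasing a a'∈)) (P-closed pa a'∈)

      avoids : ∀ {a'} → a' ∈ movesA a → GA.grundy a' ≢ GB.grundy (f a)
      avoids a'∈ g≡ with adjacent pa a'∈
      ... | inj₁ forward  = GB.grundy-option-≢ forward (trans (sym (IH a'∈)) g≡)
      ... | inj₂ backward = GB.grundy-option-≢ backward (sym (trans (sym (IH a'∈)) g≡))

      covers : ∀ {w} → w < GB.grundy (f a) → ∃[ a' ] a' ∈ movesA a × w ≡ GA.grundy a'
      covers w< with GB.below-grundy w<
      ... | inj₁ (terminal , refl) with a'' , a''∈ , g≡0 ← escape pa terminal a₀∈ =
        a'' , a''∈ , sym (trans (IH a''∈) g≡0)
      ... | inj₂ (b , b∈ , refl) with a' , a'∈ , refl ← lift pa b∈ =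
        a' , a'∈ , sym (IH a'∈)

    grundy-transfer : ∀ {a} → P a → GA.grundy a ≡ GB.grundy (f a)
    grundy-transfer {a} = grundy-transfer-acc (<-wellFounded (μA a))

infix 4 _↝_

data _↝_ : List ℕ → List ℕ → Set where
  reduce : ∀ {x c xs} → c < x → x ∷ xs ↝ c ∷ xs
  skip   : ∀ {x xs ys} → xs ↝ ys → x ∷ xs ↝ x ∷ ys

∈-nimMoves⁺ : ∀ {xs ys} → xs ↝ ys → ys ∈ nimMoves xs
∈-nimMoves⁺ {x ∷ xs} (reduce c<x) = ∈-++⁺ˡ (∈-map⁺ (_∷ xs) (∈-upTo⁺ c<x))
∈-nimMoves⁺ {x ∷ xs} (skip step)  = ∈-++⁺ʳ (map (_∷ xs) (upTo x)) (∈-map⁺ (x ∷_) (∈-nimMoves⁺ step))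

∈-nimMoves⁻ : ∀ xs {ys} → ys ∈ nimMoves xs → xs ↝ ys
∈-nimMoves⁻ (x ∷ xs) ys∈ with ∈-++⁻ (map (_∷ xs) (upTo x)) ys∈
... | inj₁ ∈reduced with _ , c∈ , refl ← ∈-map⁻ (_∷ xs) ∈reduced = reduce (∈-upTo⁻ c∈)
... | inj₂ ∈skipped with _ , ys∈ , refl ← ∈-map⁻ (x ∷_) ∈skipped = skip (∈-nimMoves⁻ xs ys∈)

↝-sum< : ∀ {xs ys} → xs ↝ ys → sum ys < sum xs
↝-sum< {_ ∷ xs} (reduce c<x) = +-monoˡ-< (sum xs) c<x
↝-sum< {x ∷ _}  (skip step)  = +-monoʳ-< x (↝-sum< step)

nimMoves-sum< : ∀ xs {ys} → ys ∈ nimMoves xs → sum ys < sum xs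
nimMoves-sum< xs = ↝-sum< ∘ ∈-nimMoves⁻ xs

module Nim = Grundy nimMoves sum nimMoves-sum<

sum>0⇒↝ : ∀ {xs} → 0 < sum xs → ∃[ ys ] xs ↝ ys
sum>0⇒↝ {zero  ∷ xs} sum>0 = let ys , step = sum>0⇒↝ sum>0 in zero ∷ ys , skip step
sum>0⇒↝ {suc x ∷ xs} _     = x ∷ xs , reduce ≤-refl

nimMoves≡[]⇒sum≡0 : ∀ xs → nimMoves xs ≡ [] → sum xs ≡ 0
nimMoves≡[]⇒sum≡0 xs terminal with sum xs | sum>0⇒↝ {xs}
... | zero  | _       = refl
... | suc _ | options with ys , step ← options z<s =
  contradiction (subst (ys ∈_) terminal (∈-nimMoves⁺ step)) λ ()

grundyNim-sum≡1 : ∀ xs → sum xs ≡ 1 → grundyNim xs ≡ 0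
grundyNim-sum≡1 xs sum≡1 with ys , step ← sum>0⇒↝ {xs} (subst (0 <_) (sym sum≡1) z<s) =
  Nim.grundy-unique {xs} (∈-nimMoves⁺ step) avoids-0 λ ()
  where
  avoids-0 : ∀ {ys} → ys ∈ nimMoves xs → grundyNim ys ≢ 0
  avoids-0 {ys} ys∈ g≡0 = 1+n≢0 (trans (sym (Nim.grundy-terminal {ys} terminal)) g≡0)
    where
    terminal : nimMoves ys ≡ []
    terminal = Nim.μ≡0⇒terminal {ys} (n<1⇒n≡0 (subst (sum ys <_) sum≡1 (nimMoves-sum< xs ys∈)))

≤ᵇ-true : ∀ {m n} → m ≤ n → (m ≤ᵇ n) ≡ true
≤ᵇ-true {m} {n} m≤n = det (≤ᵇ-reflects-≤ m n) (ofʸ m≤n)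

≤ᵇ-false : ∀ {m n} → n < m → (m ≤ᵇ n) ≡ false
≤ᵇ-false {m} {n} n<m = det (≤ᵇ-reflects-≤ m n) (ofⁿ (<⇒≱ n<m))

headOr0-≤ : ∀ {x xs} → IsPartition (x ∷ xs) → headOr0 xs ≤ x
headOr0-≤ [-]       = z≤n
headOr0-≤ (y≤x ∷ _) = y≤x

∷-partition : ∀ {x xs} → headOr0 xs ≤ x → IsPartition xs → IsPartition (x ∷ xs)
∷-partition {xs = []}    _   _  = [-]
∷-partition {xs = _ ∷ _} y≤x p  = y≤x ∷ p

any-≤ᵇ-true : ∀ {j} xs → suc j ≤ headOr0 xs → any (suc j ≤ᵇ_) xs ≡ true
any-≤ᵇ-true (x ∷ xs) k≤x rewrite ≤ᵇ-true k≤x = refl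

any-≤ᵇ-false : ∀ {k xs} → IsPartition xs → headOr0 xs < k → any (k ≤ᵇ_) xs ≡ false
any-≤ᵇ-false {xs = []}     _ _   = refl
any-≤ᵇ-false {xs = x ∷ xs} p x<k
  rewrite ≤ᵇ-false x<k | any-≤ᵇ-false (tail p) (≤-<-trans (headOr0-≤ p) x<k) = refl

ritMove-pass : ∀ {j} x xs → suc j ≤ headOr0 xs → ritMove (suc j) (x ∷ xs) ≡ x ∷ ritMove (suc j) xs
ritMove-pass x xs k≤h rewrite any-≤ᵇ-true xs k≤h = refl

ritMove-stop : ∀ {j x xs} → IsPartition xs → headOr0 xs < suc j → suc j ≤ x →
               ritMove (suc j) (x ∷ xs) ≡ j ∷ xs
ritMove-stop p h<k k≤x rewrite any-≤ᵇ-false p h<k | ≤ᵇ-true k≤x = refl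

-- Stated for all lists, not only partitions, because the fuel measure `sum` must decrease
-- along every move.
ritMove-sum< : ∀ j xs → any (suc j ≤ᵇ_) xs ≡ true → sum (ritMove (suc j) xs) < sum xs
ritMove-sum< j (x ∷ xs) exceeds
  with any (suc j ≤ᵇ_) xs in exceeds′ | suc j ≤ᵇ x | ≤ᵇ-reflects-≤ (suc j) x
... | true  | _    | _       = +-monoʳ-< x (ritMove-sum< j xs exceeds′)
... | false | true | ofʸ k≤x = +-monoˡ-< (sum xs) k≤x
ritMove-sum< j (x ∷ xs) () | false | false | _

headOr0-ritMove : ∀ j xs → headOr0 (ritMove (suc j) xs) ≤ headOr0 xs
headOr0-ritMove j []       = z≤n
headOr0-ritMove j (x ∷ xs) with any (suc j ≤ᵇ_) xs | suc j ≤ᵇ x | ≤ᵇ-reflects-≤ (suc j) x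
... | true  | _     | _       = ≤-refl
... | false | true  | ofʸ k≤x = <⇒≤ k≤x
... | false | false | _       = ≤-refl

ritMove-partition : ∀ {j} xs → IsPartition xs → suc j ≤ headOr0 xs →
                    IsPartition (ritMove (suc j) xs)
ritMove-partition {j} (x ∷ xs) p k≤x with suc j ≤? headOr0 xs
... | yes k≤h rewrite ritMove-pass x xs k≤h =
  ∷-partition (≤-trans (headOr0-ritMove j xs) (headOr0-≤ p)) (ritMove-partition xs (tail p) k≤h)
... | no  k≰h rewrite ritMove-stop (tail p) (≰⇒> k≰h) k≤x =
  ∷-partition (≤-pred (≰⇒> k≰h)) (tail p)

∈-ritMoves⁺ : ∀ xs {j} → suc j ≤ headOr0 xs → ritMove (suc j) xs ∈ ritMoves xs
∈-ritMoves⁺ xs k≤h = ∈-map⁺ (λ j → ritMove (suc j) xs) (∈-upTo⁺ k≤h)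

∈-ritMoves⁻ : ∀ {xs ys} → ys ∈ ritMoves xs → ∃[ j ] suc j ≤ headOr0 xs × ys ≡ ritMove (suc j) xs
∈-ritMoves⁻ {xs} ys∈ with j , j∈ , ys≡ ← ∈-map⁻ (λ j → ritMove (suc j) xs) ys∈ =
  j , ∈-upTo⁻ j∈ , ys≡

ritMoves-sum< : ∀ xs {ys} → ys ∈ ritMoves xs → sum ys < sum xs
ritMoves-sum< xs ys∈ with j , k≤h , refl ← ∈-ritMoves⁻ {xs} ys∈ =
  ritMove-sum< j xs (any-≤ᵇ-true xs k≤h)

-- Shortening row 2i − 1 lowers entry i of rem; shortening row 2i raises it.
rem-ritMove-adjacent : ∀ {j} xs → IsPartition xs → suc j ≤ headOr0 xs →
                       rem xs ↝ rem (ritMove (suc j) xs) ⊎ rem (ritMove (suc j) xs) ↝ rem xs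
rem-ritMove-adjacent (a ∷ []) _ k≤a rewrite ritMove-stop [] z<s k≤a = inj₁ (reduce k≤a)
rem-ritMove-adjacent {j} (a ∷ b ∷ xs) (b≤a ∷ p) k≤a with suc j ≤? b
... | no k≰b rewrite ritMove-stop p (≰⇒> k≰b) k≤a =
  inj₁ (reduce (∸-monoˡ-< k≤a (≤-pred (≰⇒> k≰b))))
... | yes k≤b with suc j ≤? headOr0 xs
...   | no  k≰h rewrite ritMove-pass a (b ∷ xs) k≤b | ritMove-stop (tail p) (≰⇒> k≰h) k≤b =
  inj₂ (reduce (∸-monoʳ-< k≤b b≤a))
...   | yes k≤h rewrite ritMove-pass a (b ∷ xs) k≤b | ritMove-pass b xs k≤h =
  Sum.map skip skip (rem-ritMove-adjacent xs (tail p) k≤h)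

-- Lowering the entry a ∸ b of rem to c is done by cutting the row a down to b + c.
rem-ritMove-surjective : ∀ xs {ys} → IsPartition xs → rem xs ↝ ys →
                         ∃[ j ] suc j ≤ headOr0 xs × rem (ritMove (suc j) xs) ≡ ys
rem-ritMove-surjective (a ∷ []) {c ∷ _} _ (reduce c<a) =
  c , c<a , cong rem (ritMove-stop [] z<s c<a)
rem-ritMove-surjective (a ∷ b ∷ xs) {c ∷ _} (b≤a ∷ p) (reduce c<a∸b) =
  b + c , b+c<a , (begin
    rem (ritMove (suc (b + c)) (a ∷ b ∷ xs)) ≡⟨ cong rem (ritMove-stop p (s≤s (m≤m+n b c)) b+c<a) ⟩
    (b + c ∸ b) ∷ rem xs                      ≡⟨ cong (_∷ rem xs) (m+n∸m≡n b c) ⟩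
    c ∷ rem xs                                ∎)
  where
  open ≡-Reasoning
  b+c<a : b + c < a
  b+c<a = subst (b + c <_) (m+[n∸m]≡n b≤a) (+-monoʳ-< b c<a∸b)
rem-ritMove-surjective (a ∷ b ∷ xs) (b≤a ∷ p) (skip step)
  with j , k≤h , rem≡ ← rem-ritMove-surjective xs (tail p) step =
  j , ≤-trans k≤b b≤a , (begin
    rem (ritMove (suc j) (a ∷ b ∷ xs))  ≡⟨ cong rem (ritMove-pass a (b ∷ xs) k≤b) ⟩
    rem (a ∷ ritMove (suc j) (b ∷ xs))  ≡⟨ cong (rem ∘ (a ∷_)) (ritMove-pass b xs k≤h) ⟩
    (a ∸ b) ∷ rem (ritMove (suc j) xs)  ≡⟨ cong ((a ∸ b) ∷_) rem≡ ⟩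
    _                                   ∎)
  where
  open ≡-Reasoning
  k≤b : suc j ≤ b
  k≤b = ≤-trans k≤h (headOr0-≤ p)

rem-ritMove-top : ∀ {j} xs → IsPartition xs → sum (rem xs) ≡ 0 → headOr0 xs ≡ suc j →
                  sum (rem (ritMove (suc j) xs)) ≡ 1
rem-ritMove-top (a ∷ []) _ () refl
rem-ritMove-top {j} (a ∷ b ∷ xs) (b≤a ∷ p) sum≡0 refl
  with refl ← ≤-antisym b≤a (m∸n≡0⇒m≤n (m+n≡0⇒m≡0 (a ∸ b) sum≡0))
  with suc j ≤? headOr0 xs
... | yes k≤h rewrite ritMove-pass a (b ∷ xs) ≤-refl | ritMove-pass b xs k≤h =
  cong₂ _+_ (n∸n≡0 j)
    (rem-ritMove-top xs (tail p) (m+n≡0⇒n≡0 (j ∸ j) sum≡0) (≤-antisym (headOr0-≤ p) k≤h))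
... | no  k≰h rewrite ritMove-pass a (b ∷ xs) ≤-refl | ritMove-stop (tail p) (≰⇒> k≰h) ≤-refl =
  cong₂ _+_ (m+n∸n≡m 1 j) (m+n≡0⇒n≡0 (j ∸ j) sum≡0)

ritMoves-partition : ∀ {xs ys} → IsPartition xs → ys ∈ ritMoves xs → IsPartition ys
ritMoves-partition {xs} p ys∈ with j , k≤h , refl ← ∈-ritMoves⁻ {xs} ys∈ =
  ritMove-partition xs p k≤h

ritMoves-rem-adjacent : ∀ {xs ys} → IsPartition xs → ys ∈ ritMoves xs →
                        rem ys ∈ nimMoves (rem xs) ⊎ rem xs ∈ nimMoves (rem ys)
ritMoves-rem-adjacent {xs} p ys∈ with j , k≤h , refl ← ∈-ritMoves⁻ {xs} ys∈ =
  Sum.map ∈-nimMoves⁺ ∈-nimMoves⁺ (rem-ritMove-adjacent xs p k≤h)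

nimMoves-rem-lift : ∀ {xs zs} → IsPartition xs → zs ∈ nimMoves (rem xs) →
                    ∃[ ys ] ys ∈ ritMoves xs × rem ys ≡ zs
nimMoves-rem-lift {xs} p zs∈
  with j , k≤h , rem≡ ← rem-ritMove-surjective xs p (∈-nimMoves⁻ (rem xs) zs∈) =
  ritMove (suc j) xs , ∈-ritMoves⁺ xs k≤h , rem≡

rem-terminal-escape : ∀ {xs ys} → IsPartition xs → nimMoves (rem xs) ≡ [] → ys ∈ ritMoves xs →
                      ∃[ zs ] zs ∈ ritMoves xs × grundyNim (rem zs) ≡ 0
rem-terminal-escape {[]}         _ _ ()
rem-terminal-escape {zero ∷ _}   _ _ ()
rem-terminal-escape {suc a ∷ xs} p terminal _ =
  ritMove (suc a) xs′ , ∈-ritMoves⁺ xs′ ≤-refl ,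
  grundyNim-sum≡1 (rem (ritMove (suc a) xs′))
    (rem-ritMove-top xs′ p (nimMoves≡[]⇒sum≡0 (rem xs′) terminal) refl)
  where
  xs′ : List ℕ
  xs′ = suc a ∷ xs

theorem4p1 : (λs : List ℕ) → IsPartition λs → grundyRIT λs ≡ grundyNim (rem λs)
theorem4p1 _ = grundy-transfer rem IsPartition
  ritMoves-partition ritMoves-rem-adjacent nimMoves-rem-lift rem-terminal-escape
  where open GrundyTransfer ritMoves sum ritMoves-sum< nimMoves sum nimMoves-sum<
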